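{- Let $m\ge 2$, $n\ge 1$, and let $C$ be any permissible configuration on the $m\times n$ grid. If $2\le r\le m$, then $$|C\cap(\{r-1\}\times[n])|\le n-\left\lfloor\frac{|C\cap(\{r\}\times[n])|}{3}\right\rfloor.$$
   Context: The $m\times n$ grid is $[m]\times[n]=\{(i,j):1\le i\le m,\ 1\le j\le n\}$; $(i,j)$ is the lot in row $i$ and column $j$, rows counted from the north (row $1$ northernmost, row $m$ southernmost) and columns from the west. A configuration is a subset $C\subseteq[m]\times[n]$ (the occupied lots). A house at $(i,j)\in C$ is blocked from sunlight if $(i,j+1)$, $(i,j-1)$, $(i+1,j)$ all lie in the grid and are all occupied (lots outside the grid never obstruct sunlight). A configuration is permissible if no house in it is blocked. -}

module Defs where

open import Data.Nat using (ℕ; zero; suc; _+_; _∸_; _/_; _≤_; _<_)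
open import Data.Nat.Properties using (_<?_)
open import Data.Fin using (Fin; toℕ; fromℕ<)
open import Data.Bool using (Bool; true; false; if_then_else_)
open import Data.Product using (_×_; Σ)
open import Data.Sum using (_⊎_)
open import Relation.Binary.PropositionalEquality using (_≡_)
open import Relation.Nullary using (¬_; yes; no)

-- Fin m / Fin n index rows / columns 0-based:
-- the lot (i , j) (1-based, as in the paper) corresponds to
-- (toℕ i' + 1 , toℕ j' + 1).  Row index 0 is the northernmost row.
Config : ℕ → ℕ → Set
Config m n = Fin m → Fin n → Bool

Occupied : ∀ {m n} → Config m n → ℕ → ℕ → Set
Occupied {m} {n} C i j =
  Σ (1 ≤ i × i ≤ m) λ { _ →
  Σ (1 ≤ j × j ≤ n) λ { _ →
  Σ (i ∸ 1 < m) λ hi → Σ (j ∸ 1 < n) λ hj →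
    C (fromℕ< hi) (fromℕ< hj) ≡ true } }

Blocked : ∀ {m n} → Config m n → ℕ → ℕ → Set
Blocked C i j =
  Occupied C i j × Occupied C i (suc j) × Occupied C i (j ∸ 1) × Occupied C (suc i) j

Permissible : ∀ {m n} → Config m n → Set
Permissible C = ∀ i j → ¬ Blocked C i j

countFin : ∀ {n} → (Fin n → Bool) → ℕ
countFin {zero} f = 0
countFin {suc n} f = (if f Fin.zero then 1 else 0) + countFin {n} (λ k → f (Fin.suc k))

-- |C ∩ ({r} × [n])| for 1-based row r (0 if r is outside [1, m])
rowCount : ∀ {m n} → Config m n → ℕ → ℕ
rowCount {m} {n} C r with r ∸ 1 <? m
... | yes h = countFin (C (fromℕ< h))
... | no _ = 0

{-# OPTIONS --safe #-}
module Submission where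

-- Read the two rows column by column, from west to east, with row r − 1 above
-- row r.  A column weighs 3 for a house in row r − 1 plus 1 for a house in row
-- r, so it is enough to show that the total weight is at most 3n + 2.  A column
-- of weight 4 in the interior of a run of houses of row r − 1 would have a
-- blocked house on top, so heavy columns sit at the ends of runs and are paid
-- for by the empty lots separating runs.  The bookkeeping is a potential: the
-- columns still to be read weigh at most 3 each plus 2, minus one for a house
-- just read in row r − 1, minus one more if that house closes a heavy column
-- inside a run (which forces the next lot of row r − 1 to be empty).

open import Defs
open import Data.Nat using (ℕ; zero; suc; _+_; _*_; _∸_; _/_; _≤_; _<_; z≤n; s≤s; s≤s⁻¹)
open import Data.Nat.Properties
open import Data.Nat.DivMod using (m/n*n≤m)
open import Data.Nat.Tactic.RingSolver using (solve-∀)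
open import Data.Bool using (Bool; true; false; _∧_; if_then_else_)
open import Data.Bool.Properties using (¬-not)
open import Data.Fin using (Fin; fromℕ<)
open import Data.Product using (Σ; _×_; _,_)
open import Relation.Binary.PropositionalEquality using (_≡_; _≢_; refl; cong₂; module ≡-Reasoning)
open import Relation.Nullary using (yes; no; contradiction)

𝟙 : Bool → ℕ
𝟙 b = if b then 1 else 0

𝟙≤1 : ∀ b → 𝟙 b ≤ 1
𝟙≤1 true  = ≤-refl
𝟙≤1 false = z≤n

_◂_ : Bool → (ℕ → Bool) → ℕ → Bool
(b ◂ U) zero    = b
(b ◂ U) (suc j) = U j

Unblocked : (ℕ → Bool) → (ℕ → Bool) → Set
Unblocked U D = ∀ j → U j ∧ U (1 + j) ∧ U (2 + j) ∧ D (1 + j) ≡ false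

unblocked-tail : ∀ U D → Unblocked U D → Unblocked (λ j → U (suc j)) (λ j → D (suc j))
unblocked-tail U D unblocked j = unblocked (suc j)

unblocked-◂false : ∀ {U D b} → Unblocked U D → Unblocked (false ◂ U) (b ◂ D)
unblocked-◂false unblocked zero    = refl
unblocked-◂false unblocked (suc j) = unblocked j

columnWeight : Bool → Bool → ℕ
columnWeight u d = 𝟙 u * 3 + 𝟙 d

weight : ℕ → (ℕ → Bool) → (ℕ → Bool) → ℕ
weight zero    U D = 0
weight (suc n) U D = columnWeight (U 0) (D 0) + weight n (λ j → U (suc j)) (λ j → D (suc j))

potential : Bool → Bool → Bool → ℕ
potential u₀ false d₁ = 0
potential false true d₁ = 1
potential true true d₁ = suc (𝟙 d₁)

potential≤2 : ∀ u₀ u₁ d₁ → potential u₀ u₁ d₁ ≤ 2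
potential≤2 u₀ false d₁ = z≤n
potential≤2 false true d₁ = s≤s z≤n
potential≤2 true true d₁ = s≤s (𝟙≤1 d₁)

potential-step : ∀ u₀ u₁ u₂ d₁ d₂ → u₀ ∧ u₁ ∧ u₂ ∧ d₁ ≡ false →
  potential u₀ u₁ d₁ + columnWeight u₂ d₂ ≤ 3 + potential u₁ u₂ d₂
potential-step u₀ u₁ false d₁ d₂ _ = +-mono-≤ (potential≤2 u₀ u₁ d₁) (𝟙≤1 d₂)
potential-step u₀ false true d₁ d₂ _ = s≤s (s≤s (s≤s (𝟙≤1 d₂)))
potential-step false true true d₁ d₂ _ = ≤-refl
potential-step true true true false d₂ _ = ≤-refl
potential-step true true true true d₂ ()

potential+weight≤ : ∀ n U D → Unblocked U D →
  potential (U 0) (U 1) (D 1) + weight n (λ j → U (2 + j)) (λ j → D (2 + j)) ≤ 2 + n * 3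
potential+weight≤ zero U D _ = begin
  potential (U 0) (U 1) (D 1) + 0 ≡⟨ +-identityʳ _ ⟩
  potential (U 0) (U 1) (D 1)     ≤⟨ potential≤2 (U 0) (U 1) (D 1) ⟩
  2                               ∎
  where open ≤-Reasoning
potential+weight≤ (suc n) U D unblocked = begin
  p + (w + rest)  ≡⟨ +-assoc p w rest ⟨
  (p + w) + rest  ≤⟨ +-monoˡ-≤ rest (potential-step (U 0) (U 1) (U 2) (D 1) (D 2) (unblocked 0)) ⟩
  3 + (p′ + rest) ≤⟨ +-monoʳ-≤ 3 (potential+weight≤ n (λ j → U (suc j)) (λ j → D (suc j)) (unblocked-tail U D unblocked)) ⟩
  2 + suc n * 3   ∎
  where
  open ≤-Reasoning
  p = potential (U 0) (U 1) (D 1)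
  p′ = potential (U 1) (U 2) (D 2)
  w = columnWeight (U 2) (D 2)
  rest = weight n (λ j → U (3 + j)) (λ j → D (3 + j))

∧-true : ∀ a b c e → a ∧ b ∧ c ∧ e ≡ true → a ≡ true × b ≡ true × c ≡ true × e ≡ true
∧-true true true true true refl = refl , refl , refl , refl

pad : ∀ {n} → (Fin n → Bool) → ℕ → Bool
pad {zero}  f k       = false
pad {suc n} f zero    = f Fin.zero
pad {suc n} f (suc k) = pad (λ i → f (Fin.suc i)) k

pad-true : ∀ {n} (f : Fin n → Bool) k → pad f k ≡ true → Σ (k < n) λ k<n → f (fromℕ< k<n) ≡ true
pad-true {suc n} f zero    fk≡true = s≤s z≤n , fk≡true
pad-true {suc n} f (suc k) fk≡true with pad-true (λ i → f (Fin.suc i)) k fk≡true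
... | k<n , fk≡true′ = s≤s k<n , fk≡true′

weight-pad : ∀ n (u d : Fin n → Bool) → weight n (pad u) (pad d) ≡ countFin u * 3 + countFin d
weight-pad zero    u d = refl
weight-pad (suc n) u d = begin
  columnWeight (u Fin.zero) (d Fin.zero) + weight n (pad u′) (pad d′)
    ≡⟨ cong₂ _+_ refl (weight-pad n u′ d′) ⟩
  (𝟙 (u Fin.zero) * 3 + 𝟙 (d Fin.zero)) + (countFin u′ * 3 + countFin d′)
    ≡⟨ regroup (𝟙 (u Fin.zero)) (𝟙 (d Fin.zero)) (countFin u′) (countFin d′) ⟩
  countFin u * 3 + countFin d ∎
  where
  open ≡-Reasoning
  u′ = λ i → u (Fin.suc i)
  d′ = λ i → d (Fin.suc i)
  regroup : ∀ a b c e → (a * 3 + b) + (c * 3 + e) ≡ (a + c) * 3 + (b + e)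
  regroup = solve-∀

pad-true⇒occupied : ∀ {m n} (C : Config m n) {i} (i<m : i < m) {k} →
  pad (C (fromℕ< i<m)) k ≡ true → Occupied C (suc i) (suc k)
pad-true⇒occupied C i<m {k} occ with pad-true _ k occ
... | k<n , occ′ = (s≤s z≤n , i<m) , (s≤s z≤n , k<n) , i<m , k<n , occ′

permissible⇒unblocked : ∀ {m n} (C : Config m n) → Permissible C →
  ∀ {i} (i<m : i < m) (1+i<m : suc i < m) →
  Unblocked (pad (C (fromℕ< i<m))) (pad (C (fromℕ< 1+i<m)))
permissible⇒unblocked C permissible {i} i<m 1+i<m k = ¬-not blocked
  where
  u = pad (C (fromℕ< i<m))
  d = pad (C (fromℕ< 1+i<m))
  blocked : u k ∧ u (1 + k) ∧ u (2 + k) ∧ d (1 + k) ≢ true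
  blocked all-occupied with ∧-true (u k) (u (1 + k)) (u (2 + k)) (d (1 + k)) all-occupied
  ... | west , centre , east , south = permissible (suc i) (2 + k)
    ( pad-true⇒occupied C i<m centre , pad-true⇒occupied C i<m east
    , pad-true⇒occupied C i<m west , pad-true⇒occupied C 1+i<m south )

m*3+n≤2+o*3⇒m≤o∸n/3 : ∀ m n o → m * 3 + n ≤ 2 + o * 3 → m ≤ o ∸ n / 3
m*3+n≤2+o*3⇒m≤o∸n/3 m n o le = m+n≤o⇒m≤o∸n m (s≤s⁻¹ (*-cancelʳ-< 3 (m + n / 3) (suc o) lt))
  where
  open ≤-Reasoning
  lt : (m + n / 3) * 3 < suc o * 3
  lt = begin-strict
    (m + n / 3) * 3     ≡⟨ *-distribʳ-+ 3 m (n / 3) ⟩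
    m * 3 + n / 3 * 3   ≤⟨ +-monoʳ-≤ (m * 3) (m/n*n≤m n 3) ⟩
    m * 3 + n           ≤⟨ le ⟩
    2 + o * 3           <⟨ ≤-refl ⟩
    suc o * 3           ∎

adjacent-rows-bound : ∀ {m n} (C : Config m n) → Permissible C →
  ∀ {i} (i<m : i < m) (1+i<m : suc i < m) →
  countFin (C (fromℕ< i<m)) * 3 + countFin (C (fromℕ< 1+i<m)) ≤ 2 + n * 3
adjacent-rows-bound {n = n} C permissible i<m 1+i<m = begin
  countFin u * 3 + countFin d ≡⟨ weight-pad n u d ⟨
  weight n (pad u) (pad d)    ≤⟨ potential+weight≤ n (false ◂ (false ◂ pad u)) (false ◂ (false ◂ pad d)) unblocked ⟩
  2 + n * 3                   ∎
  where
  open ≤-Reasoning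
  u = C (fromℕ< i<m)
  d = C (fromℕ< 1+i<m)
  unblocked : Unblocked (false ◂ (false ◂ pad u)) (false ◂ (false ◂ pad d))
  unblocked = unblocked-◂false {b = false} (unblocked-◂false {b = false} (permissible⇒unblocked C permissible i<m 1+i<m))

lemma4p11 : (m n : ℕ) → 2 ≤ m → 1 ≤ n → (C : Config m n) → Permissible C →
    (r : ℕ) → 2 ≤ r → r ≤ m →
    rowCount C (r ∸ 1) ≤ n ∸ (rowCount C r / 3)
lemma4p11 m n _ _ C permissible (suc zero) (s≤s ()) _
lemma4p11 m n _ _ C permissible (suc (suc i)) _ 2+i≤m with i <? m | suc i <? m
... | yes i<m | yes 1+i<m = m*3+n≤2+o*3⇒m≤o∸n/3 _ _ n (adjacent-rows-bound C permissible i<m 1+i<m)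
... | no i≮m  | _         = contradiction (<-trans (n<1+n i) 2+i≤m) i≮m
... | _       | no 1+i≮m  = contradiction 2+i≤m 1+i≮m
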